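{- Let $q\ge 4$ be a power of $2$. Then there exists a linear AOA$(1,3,q+2,q)$.
   Context: An orthogonal array OA$(t,k,v)$ is a $v^t\times k$ array with entries from a set $X$ of size $v$ such that the restriction to any $t$ columns contains every $t$-tuple of $X^t$ exactly once. An AOA$(s,t,k,v)$ is a $v^t\times (k+1)$ array $A$ such that: (1) the first $k$ columns form an OA$(t,k,v)$ on a set $X$ with $|X|=v$; (2) the last column has symbols from a set $Y$ with $|Y|=v^{t-s}$; (3) any $s$ of the first $k$ columns together with the last column contain every $(s+1)$-tuple of $X^s\times Y$ exactly once. A linear AOA$(s,t,k,q)$ is an AOA$(s,t,k,q)$ with $X=\mathbb{F}_q$, $Y=\mathbb{F}_q^{t-s}$, whose set of rows, each regarded as a vector of $\mathbb{F}_q^{k+t-s}$ (first $k$ entries followed by the $t-s$ coordinates of the last entry), is a $t$-dimensional $\mathbb{F}_q$-subspace. -}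

module Defs where

open import Level using (0ℓ)
open import Data.Nat using (ℕ; zero; suc; _∸_)
import Data.Nat as ℕ
open import Data.Fin using (Fin; zero; suc; _↑ˡ_; _↑ʳ_)
open import Data.Product using (Σ; _×_; ∃)
open import Relation.Binary.PropositionalEquality using (_≡_; _≢_)
open import Algebra.Structures using (IsCommutativeRing)
open import Function.Bundles using (_↔_)
open import Function.Definitions using (Injective)

record FiniteField (q : ℕ) : Set₁ where
  field
    Carrier : Set
    _+_ : Carrier → Carrier → Carrier
    _*_ : Carrier → Carrier → Carrier
    -_  : Carrier → Carrier
    0# 1# : Carrier
    isCommutativeRing : IsCommutativeRing _≡_ _+_ _*_ -_ 0# 1#
    0≢1 : 0# ≢ 1#
    inverse : ∀ x → x ≢ 0# → ∃ λ y → x * y ≡ 1#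
    card : Carrier ↔ Fin q

module _ {q : ℕ} (F : FiniteField q) where
  open FiniteField F

  sumF : ∀ n → (Fin n → Carrier) → Carrier
  sumF zero    f = 0#
  sumF (suc n) f = f zero + sumF n (λ i → f (suc i))

  ExactlyOne : ∀ t → ((Fin t → Carrier) → Set) → Set
  ExactlyOne t P =
    Σ (Fin t → Carrier) λ x → P x × (∀ x' → P x' → ∀ i → x' i ≡ x i)

  -- The rows of the array are thus exactly the elements of the row space of G
  -- (each listed once when the OA property holds), i.e. a linear subspace.
  rowOf : ∀ t n → (Fin t → Fin n → Carrier) → (Fin t → Carrier) → Fin n → Carrier
  rowOf t n G x j = sumF t (λ i → x i * G i j)

  -- The array with rows {xG : x ∈ F^t} is an AOA(s,t,k,q) with X = F,
  -- Y = F^(t-s) (last column = last t-s coordinates).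
  IsLinearAOAGen : (s t k : ℕ) → (Fin t → Fin (k ℕ.+ (t ∸ s)) → Carrier) → Set
  IsLinearAOAGen s t k G =
    ( (c : Fin t → Fin k) → Injective _≡_ _≡_ c →
      (y : Fin t → Carrier) →
      ExactlyOne t (λ x → ∀ i → row x (c i ↑ˡ (t ∸ s)) ≡ y i) )
    ×
    ( (d : Fin s → Fin k) → Injective _≡_ _≡_ d →
      (y : Fin s → Carrier) → (z : Fin (t ∸ s) → Carrier) →
      ExactlyOne t (λ x → (∀ i → row x (d i ↑ˡ (t ∸ s)) ≡ y i)
                        × (∀ j → row x (k ↑ʳ j) ≡ z j)) )
    where
      row = rowOf t (k ℕ.+ (t ∸ s)) G

  LinearAOA : (s t k : ℕ) → Set
  LinearAOA s t k = Σ (Fin t → Fin (k ℕ.+ (t ∸ s)) → Carrier) (IsLinearAOAGen s t k)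

module Submission where

-- The q + 2 points (1, t, t²), (0, 0, 1) and (0, 1, 0) form a hyperoval of the
-- projective plane over F when q is even: no three of them are collinear, the
-- nucleus (0, 1, 0) being special to characteristic 2. Taking them as the first
-- q + 2 columns of a 3 × (q + 4) generator matrix G, any three of these columns
-- form an invertible matrix, so by Cramer's rule the rows xG (x ∈ F³) form an
-- OA(3, q + 2, q). The last two columns span the line e x₀ + x₁ + x₂ = 0, where
-- e is a value not taken by t ↦ t + t² (that map identifies t and t + 1, so it is
-- not onto). This line misses the hyperoval, hence each hyperoval point together
-- with it is again a basis, which is the augmented property. Characteristic 2
-- itself comes from q = 2ᵐ: translation by 1 permutes F, so 2ᵐ · 1 = 0, which forces
-- 2 · 1 = 0 since F has no zero divisors.

open import Defs
open import Level using (0ℓ)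
open import Data.Nat as ℕ using (ℕ; zero; suc; _^_)
open import Data.Nat.Properties using (n<1+n)
open import Data.Bool using (Bool; true; false; _xor_; _∧_; if_then_else_)
open import Data.Bool.Properties using (xor-∧-commutativeRing) renaming (_≟_ to _≟ᵇ_)
open import Data.Fin using (Fin; zero; suc; splitAt; _↑ˡ_; _↑ʳ_; combine; remQuot)
open import Data.Fin.Patterns using (0F; 1F; 2F)
open import Data.Fin.Permutation using (Permutation; permutation)
open import Data.Fin.Properties
  using (any?; all?; <⇒notInjective; splitAt-↑ˡ; splitAt-↑ʳ; +↔⊎; inj⇒≟)
  renaming (_≟_ to _≟ᶠ_)
open import Data.Maybe using (map)
open import Data.Product using (∃; _,_; proj₁; proj₂; uncurry)
open import Data.Sum using (_⊎_; inj₁; inj₂; [_,_]′)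
open import Data.Vec using (Vec; tabulate)
open import Data.Vec.Functional using (_∷_; [])
open import Data.Empty using (⊥-elim)
open import Function using (_∘_)
open import Function.Bundles using (_↔_; Inverse; Injection)
open import Function.Definitions using (Injective)
open import Function.Properties.Inverse using (↔⇒↣; ↔-sym)
open import Relation.Nullary using (Dec; yes; no; ¬?; dec⇒maybe)
open import Relation.Nullary.Decidable using (decidable-stable)
open import Relation.Binary.PropositionalEquality
open import Algebra.Bundles using (CommutativeRing; CommutativeSemiring; RawRing; RawSemiring)
open import Algebra.Solver.Ring.AlmostCommutativeRing
  using (fromCommutativeSemiring; _-Raw-AlmostCommutative⟶_)
import Algebra.Properties.Group as GroupProperties
import Algebra.Properties.CommutativeMonoid.Sum as SumProperties
import Algebra.Properties.Semiring.Mult as MultProperties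
import Algebra.Solver.Ring as RingSolver

-- Coordinates in the plane over a raw semiring, so that the formulas can be
-- read both in a field and in the syntax of the ring solver. Cross product and
-- determinant carry no signs: they are only used in characteristic 2.
module Coordinates {c ℓ} (R : RawSemiring c ℓ) where
  open RawSemiring R

  V3 : Set c
  V3 = Fin 3 → Carrier

  -- The trailing 0# matches Defs.sumF, making x · (λ r → G r j) the j-th entry of xG.
  infix 7 _·_
  _·_ : V3 → V3 → Carrier
  x · u = x 0F * u 0F + (x 1F * u 1F + (x 2F * u 2F + 0#))

  cross : V3 → V3 → V3
  cross u v 0F = u 1F * v 2F + u 2F * v 1F
  cross u v 1F = u 2F * v 0F + u 0F * v 2F
  cross u v 2F = u 0F * v 1F + u 1F * v 0F

  det : V3 → V3 → V3 → Carrier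
  det u v w = u · cross v w

  adjugate : (Fin 3 → V3) → V3 → V3
  adjugate u y i =
    y 0F * cross (u 1F) (u 2F) i + y 1F * cross (u 2F) (u 0F) i + y 2F * cross (u 0F) (u 1F) i

  conicPoint : Carrier → V3
  conicPoint t = 1# ∷ t ∷ t * t ∷ []

  conicPoint∞ nucleusPoint : V3
  conicPoint∞  = 0# ∷ 0# ∷ 1# ∷ []
  nucleusPoint = 0# ∷ 1# ∷ 0# ∷ []

  lineThrough : Carrier → Fin 2 → V3
  lineThrough e 0F = 1# ∷ e ∷ 0# ∷ []
  lineThrough e 1F = 0# ∷ 1# ∷ 1# ∷ []

collision⇒missedValue : ∀ {n} (f : Fin n → Fin n) {i j} → i ≢ j → f i ≡ f j →
                        ∃ λ k → ∀ l → f l ≢ k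
collision⇒missedValue {n} f {i} {j} i≢j fi≡fj with any? (λ k → all? λ l → ¬? (f l ≟ᶠ k))
... | yes missed = missed
... | no ¬missed = ⊥-elim (<⇒notInjective (n<1+n n) extend-injective)
  where
  open Data.Product using (_×_)

  preimage : ∀ k → ∃ λ l → f l ≡ k
  preimage k = decidable-stable (any? λ l → f l ≟ᶠ k)
                 λ ¬preimage → ¬missed (k , λ l fl≡k → ¬preimage (l , fl≡k))

  g : Fin n → Fin n
  g k = proj₁ (preimage k)

  f∘g : ∀ k → f (g k) ≡ k
  f∘g k = proj₂ (preimage k)

  -- Since f i ≡ f j, the section g takes the value f i to at most one of i, j.
  missed : ∃ λ r → f r ≡ f i × r ≢ g (f i)
  missed with g (f i) ≟ᶠ i
  ... | yes g[fi]≡i = j , sym fi≡fj , λ j≡g[fi] → i≢j (trans (sym g[fi]≡i) (sym j≡g[fi]))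
  ... | no  g[fi]≢i = i , refl , λ i≡g[fi] → g[fi]≢i (sym i≡g[fi])

  g-misses : ∀ k → g k ≢ proj₁ missed
  g-misses k gk≡r = let (r , fr≡fi , r≢g[fi]) = missed in
    r≢g[fi] (trans (sym gk≡r) (cong g (trans (sym (f∘g k)) (trans (cong f gk≡r) fr≡fi))))

  extend : Fin (suc n) → Fin n
  extend zero    = proj₁ missed
  extend (suc k) = g k

  extend-injective : Injective _≡_ _≡_ extend
  extend-injective {zero}  {zero}   _      = refl
  extend-injective {zero}  {suc k}  r≡gk   = ⊥-elim (g-misses k (sym r≡gk))
  extend-injective {suc k} {zero}   gk≡r   = ⊥-elim (g-misses k gk≡r)
  extend-injective {suc k} {suc k′} gk≡gk′ =
    cong suc (trans (sym (f∘g k)) (trans (cong f gk≡gk′) (f∘g k′)))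

↔Fin-collision⇒missedValue : ∀ {A : Set} {n} → A ↔ Fin n → (f : A → A) → ∀ {x y} →
                             x ≢ y → f x ≡ f y → ∃ λ e → ∀ t → f t ≢ e
↔Fin-collision⇒missedValue {n = n} card f {x} {y} x≢y fx≡fy = fromFin k , f-misses
  where
  open Inverse card renaming (to to toFin; from to fromFin)
    using (strictlyInverseˡ; strictlyInverseʳ)

  f′ : Fin n → Fin n
  f′ = toFin ∘ f ∘ fromFin

  f′∘toFin : ∀ t → f′ (toFin t) ≡ toFin (f t)
  f′∘toFin t = cong (toFin ∘ f) (strictlyInverseʳ t)

  missed : ∃ λ k → ∀ l → f′ l ≢ k
  missed = collision⇒missedValue f′ (x≢y ∘ Injection.injective (↔⇒↣ card))
             (trans (f′∘toFin x) (trans (cong toFin fx≡fy) (sym (f′∘toFin y))))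

  k : Fin n
  k = proj₁ missed

  f-misses : ∀ t → f t ≢ fromFin k
  f-misses t ft≡e = proj₂ missed (toFin t) (trans (f′∘toFin t) (trans (cong toFin ft≡e) (strictlyInverseˡ k)))

module _ {q : ℕ} (F : FiniteField q) where
  open FiniteField F using (Carrier; isCommutativeRing; 0≢1; inverse; card)

  commutativeRing : CommutativeRing 0ℓ 0ℓ
  commutativeRing = record { isCommutativeRing = isCommutativeRing }

  open CommutativeRing commutativeRing
    using (_+_; _*_; -_; 0#; 1#; +-group; +-commutativeMonoid; semiring; commutativeSemiring;
           +-identityˡ; +-identityʳ; *-identityˡ; *-identityʳ; *-assoc; *-comm; zeroˡ; zeroʳ; distribˡ)
  open GroupProperties +-group using (//-rightDividesˡ; //-rightDividesʳ; identityʳ-unique; inverseˡ-unique)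
  open SumProperties +-commutativeMonoid using (sum; sum-permute; sum-cong-≗; ∑-distrib-+; sum-replicate)
  open Inverse card renaming (to to toFin; from to fromFin)
    using (strictlyInverseˡ; strictlyInverseʳ)

  _≟_ : (x y : Carrier) → Dec (x ≡ y)
  _≟_ = inj⇒≟ (↔⇒↣ card)

  fromFin-injective : Injective _≡_ _≡_ fromFin
  fromFin-injective = Injection.injective (↔⇒↣ (↔-sym card))

  ExactlyOne-map : ∀ {t} {P Q : (Fin t → Carrier) → Set} →
                   (∀ x → P x → Q x) → (∀ x → Q x → P x) → ExactlyOne F t P → ExactlyOne F t Q
  ExactlyOne-map P⇒Q Q⇒P (x , Px , unique) = x , P⇒Q x Px , λ x′ Qx′ → unique x′ (Q⇒P x′ Qx′)

  x*y≡0⇒x≡0∨y≡0 : ∀ {x y} → x * y ≡ 0# → x ≡ 0# ⊎ y ≡ 0#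
  x*y≡0⇒x≡0∨y≡0 {x} {y} xy≡0 with x ≟ 0#
  ... | yes x≡0 = inj₁ x≡0
  ... | no  x≢0 = inj₂ (begin
    y                ≡⟨ sym (*-identityˡ y) ⟩
    1# * y           ≡⟨ cong (_* y) (trans (sym xx⁻¹≡1) (*-comm x x⁻¹)) ⟩
    x⁻¹ * x * y      ≡⟨ *-assoc x⁻¹ x y ⟩
    x⁻¹ * (x * y)    ≡⟨ cong (x⁻¹ *_) xy≡0 ⟩
    x⁻¹ * 0#         ≡⟨ zeroʳ x⁻¹ ⟩
    0#               ∎)
    where
    open ≡-Reasoning
    x⁻¹ : Carrier
    x⁻¹ = proj₁ (inverse x x≢0)
    xx⁻¹≡1 : x * x⁻¹ ≡ 1#
    xx⁻¹≡1 = proj₂ (inverse x x≢0)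

  *-≢0 : ∀ {x y} → x ≢ 0# → y ≢ 0# → x * y ≢ 0#
  *-≢0 x≢0 y≢0 xy≡0 = [ x≢0 , y≢0 ]′ (x*y≡0⇒x≡0∨y≡0 xy≡0)

  module _ where
    open MultProperties semiring using (_×_; ×-homo-1; ×1-homo-*)

    card×1≡0 : q × 1# ≡ 0#
    card×1≡0 = identityʳ-unique (sum fromFin) (q × 1#) (begin
      sum fromFin + q × 1#                 ≡⟨ cong (sum fromFin +_) (sym (sum-replicate q)) ⟩
      sum fromFin + sum {q} (λ _ → 1#)     ≡⟨ sym (∑-distrib-+ fromFin (λ _ → 1#)) ⟩
      sum (λ i → fromFin i + 1#)           ≡⟨ sum-cong-≗ (λ i → sym (strictlyInverseʳ (fromFin i + 1#))) ⟩
      sum (fromFin ∘ (translation ⟨$⟩ʳ_))  ≡⟨ sym (sum-permute fromFin translation) ⟩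
      sum fromFin                          ∎)
      where
      open ≡-Reasoning
      open Data.Fin.Permutation using (_⟨$⟩ʳ_)
      translation : Permutation q q
      translation = permutation (λ i → toFin (fromFin i + 1#)) (λ i → toFin (fromFin i + - 1#))
        (λ i → trans (cong (λ x → toFin (x + 1#)) (strictlyInverseʳ _))
                     (trans (cong toFin (//-rightDividesˡ 1# (fromFin i))) (strictlyInverseˡ i)))
        (λ i → trans (cong (λ x → toFin (x + - 1#)) (strictlyInverseʳ _))
                     (trans (cong toFin (//-rightDividesʳ 1# (fromFin i))) (strictlyInverseˡ i)))

    2^m×1≡0⇒2×1≡0 : ∀ m → (2 ^ m) × 1# ≡ 0# → 2 × 1# ≡ 0#
    2^m×1≡0⇒2×1≡0 zero    1×1≡0 = ⊥-elim (0≢1 (trans (sym 1×1≡0) (×-homo-1 1#)))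
    2^m×1≡0⇒2×1≡0 (suc m) 2^[1+m]×1≡0 with x*y≡0⇒x≡0∨y≡0 (trans (sym (×1-homo-* 2 (2 ^ m))) 2^[1+m]×1≡0)
    ... | inj₁ 2×1≡0   = 2×1≡0
    ... | inj₂ 2^m×1≡0 = 2^m×1≡0⇒2×1≡0 m 2^m×1≡0

    characteristic-two : ∀ m → q ≡ 2 ^ m → 1# + 1# ≡ 0#
    characteristic-two m q≡2^m = begin
      1# + 1#         ≡⟨ cong (1# +_) (sym (+-identityʳ 1#)) ⟩
      2 × 1#          ≡⟨ 2^m×1≡0⇒2×1≡0 m (subst (λ n → n × 1# ≡ 0#) q≡2^m card×1≡0) ⟩
      0#              ∎
      where open ≡-Reasoning

  module Characteristic2 (1+1≡0 : 1# + 1# ≡ 0#) where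
    open Coordinates (CommutativeSemiring.rawSemiring commutativeSemiring)
    open Data.Product using (_×_)

    -- A ring of characteristic 2 is an 𝔽₂-algebra: the ring solver runs with
    -- coefficients in 𝔽₂ = (Bool, xor, ∧) and F seen as a commutative semiring.
    private
      𝔽₂ : RawRing 0ℓ 0ℓ
      𝔽₂ = CommutativeRing.rawRing xor-∧-commutativeRing

      ⟦_⟧ : Bool → Carrier
      ⟦ b ⟧ = if b then 1# else 0#

      ⟦⟧-homo-+ : ∀ a b → ⟦ a xor b ⟧ ≡ ⟦ a ⟧ + ⟦ b ⟧
      ⟦⟧-homo-+ false b     = sym (+-identityˡ ⟦ b ⟧)
      ⟦⟧-homo-+ true  false = sym (+-identityʳ 1#)
      ⟦⟧-homo-+ true  true  = sym 1+1≡0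

      ⟦⟧-homo-* : ∀ a b → ⟦ a ∧ b ⟧ ≡ ⟦ a ⟧ * ⟦ b ⟧
      ⟦⟧-homo-* false b = sym (zeroˡ ⟦ b ⟧)
      ⟦⟧-homo-* true  b = sym (*-identityˡ ⟦ b ⟧)

      𝔽₂⟶F : 𝔽₂ -Raw-AlmostCommutative⟶ fromCommutativeSemiring commutativeSemiring
      𝔽₂⟶F = record
        { ⟦_⟧ = ⟦_⟧ ; +-homo = ⟦⟧-homo-+ ; *-homo = ⟦⟧-homo-* ; -‿homo = λ _ → refl
        ; 0-homo = refl ; 1-homo = refl }

    open RingSolver 𝔽₂ (fromCommutativeSemiring commutativeSemiring) 𝔽₂⟶F
      (λ a b → map (cong ⟦_⟧) (dec⇒maybe (a ≟ᵇ b)))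
      using (Polynomial; _:+_; _:*_; con; var; solve; _:=_; prove)

    private
      polynomials : ℕ → RawSemiring 0ℓ 0ℓ
      polynomials n = record
        { Carrier = Polynomial n ; _≈_ = _≡_ ; _+_ = _:+_ ; _*_ = _:*_ ; 0# = con false ; 1# = con true }

      module P {n} = Coordinates (polynomials n)

      -- Variables 0 … 8 stand for the entries of a matrix u, variables 9, 10, 11 for a vector y.
      entries : (Fin 3 → V3) → V3 → Vec Carrier 12
      entries u y = tabulate ([ uncurry u ∘ remQuot 3 , y ]′ ∘ splitAt 9)

      Uᵥ : Fin 3 → P.V3
      Uᵥ i j = var (combine i j ↑ˡ 3)

      yᵥ : P.V3
      yᵥ i = var (9 ↑ʳ i)

      detᵥ : Polynomial 12
      detᵥ = P.det (Uᵥ 0F) (Uᵥ 1F) (Uᵥ 2F)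

      matrix : ∀ {A : Set} → A → A → A → A → A → A → A → A → A → Fin 3 → Fin 3 → A
      matrix a b c d e f g h i = (a ∷ b ∷ c ∷ []) ∷ (d ∷ e ∷ f ∷ []) ∷ (g ∷ h ∷ i ∷ []) ∷ []

    det-swap₀₁ : ∀ u v w → det u v w ≡ det v u w
    det-swap₀₁ u v w = solve 9 (λ a b c d e f g h i → let m = matrix a b c d e f g h i in
      P.det (m 0F) (m 1F) (m 2F) := P.det (m 1F) (m 0F) (m 2F)) refl
      (u 0F) (u 1F) (u 2F) (v 0F) (v 1F) (v 2F) (w 0F) (w 1F) (w 2F)

    det-swap₁₂ : ∀ u v w → det u v w ≡ det u w v
    det-swap₁₂ u v w = solve 9 (λ a b c d e f g h i → let m = matrix a b c d e f g h i in
      P.det (m 0F) (m 1F) (m 2F) := P.det (m 0F) (m 2F) (m 1F)) refl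
      (u 0F) (u 1F) (u 2F) (v 0F) (v 1F) (v 2F) (w 0F) (w 1F) (w 2F)

    ·-*ʳ : ∀ v w e → (λ i → v i * e) · w ≡ (v · w) * e
    ·-*ʳ v w = solve 7 (λ a b c d e f s →
      (λ i → (a ∷ b ∷ c ∷ []) i :* s) P.· (d ∷ e ∷ f ∷ []) := ((a ∷ b ∷ c ∷ []) P.· (d ∷ e ∷ f ∷ [])) :* s)
      refl (v 0F) (v 1F) (v 2F) (w 0F) (w 1F) (w 2F)

    ·-adjugate : ∀ u y i → adjugate u y · u i ≡ y i * det (u 0F) (u 1F) (u 2F)
    ·-adjugate u y 0F = prove (entries u y) (P.adjugate Uᵥ yᵥ P.· Uᵥ 0F) (yᵥ 0F :* detᵥ) refl
    ·-adjugate u y 1F = prove (entries u y) (P.adjugate Uᵥ yᵥ P.· Uᵥ 1F) (yᵥ 1F :* detᵥ) refl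
    ·-adjugate u y 2F = prove (entries u y) (P.adjugate Uᵥ yᵥ P.· Uᵥ 2F) (yᵥ 2F :* detᵥ) refl

    adjugate-· : ∀ u x r → adjugate u (λ i → x · u i) r ≡ x r * det (u 0F) (u 1F) (u 2F)
    adjugate-· u x 0F = prove (entries u x) (P.adjugate Uᵥ (λ i → yᵥ P.· Uᵥ i) 0F) (yᵥ 0F :* detᵥ) refl
    adjugate-· u x 1F = prove (entries u x) (P.adjugate Uᵥ (λ i → yᵥ P.· Uᵥ i) 1F) (yᵥ 1F :* detᵥ) refl
    adjugate-· u x 2F = prove (entries u x) (P.adjugate Uᵥ (λ i → yᵥ P.· Uᵥ i) 2F) (yᵥ 2F :* detᵥ) refl

    adjugate-cong : ∀ u {y y′} → (∀ i → y i ≡ y′ i) → ∀ r → adjugate u y r ≡ adjugate u y′ r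
    adjugate-cong u y≗y′ r =
      cong₂ _+_ (cong₂ _+_ (cong (_* _) (y≗y′ 0F)) (cong (_* _) (y≗y′ 1F))) (cong (_* _) (y≗y′ 2F))

    cramer : (u : Fin 3 → V3) → det (u 0F) (u 1F) (u 2F) ≢ 0# → (y : V3) →
             ExactlyOne F 3 (λ x → ∀ i → x · u i ≡ y i)
    cramer u D≢0 y = solution , solves , unique
      where
      open ≡-Reasoning
      D D⁻¹ : Carrier
      D = det (u 0F) (u 1F) (u 2F)
      D⁻¹ = proj₁ (inverse D D≢0)

      cancel : ∀ x → x * D * D⁻¹ ≡ x
      cancel x = trans (*-assoc x D D⁻¹) (trans (cong (x *_) (proj₂ (inverse D D≢0))) (*-identityʳ x))

      solution : V3
      solution i = adjugate u y i * D⁻¹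

      solves : ∀ i → solution · u i ≡ y i
      solves i = begin
        solution · u i               ≡⟨ ·-*ʳ (adjugate u y) (u i) D⁻¹ ⟩
        (adjugate u y · u i) * D⁻¹   ≡⟨ cong (_* D⁻¹) (·-adjugate u y i) ⟩
        y i * D * D⁻¹                ≡⟨ cancel (y i) ⟩
        y i                          ∎

      unique : ∀ x → (∀ i → x · u i ≡ y i) → ∀ r → x r ≡ solution r
      unique x x·u≡y r = begin
        x r                                   ≡⟨ sym (cancel (x r)) ⟩
        x r * D * D⁻¹                         ≡⟨ cong (_* D⁻¹) (sym (adjugate-· u x r)) ⟩
        adjugate u (λ i → x · u i) r * D⁻¹    ≡⟨ cong (_* D⁻¹) (adjugate-cong u x·u≡y r) ⟩
        solution r                            ∎

    x+x≡0 : ∀ x → x + x ≡ 0#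
    x+x≡0 x = begin
      x + x              ≡⟨ sym (cong₂ _+_ (*-identityʳ x) (*-identityʳ x)) ⟩
      x * 1# + x * 1#    ≡⟨ sym (distribˡ x 1# 1#) ⟩
      x * (1# + 1#)      ≡⟨ cong (x *_) 1+1≡0 ⟩
      x * 0#             ≡⟨ zeroʳ x ⟩
      0#                 ∎
      where open ≡-Reasoning

    +-≢0 : ∀ {x y} → x ≢ y → x + y ≢ 0#
    +-≢0 {x} {y} x≢y x+y≡0 = x≢y (trans (inverseˡ-unique x y x+y≡0) (sym (inverseˡ-unique y y (x+x≡0 y))))

    1≢0 : 1# ≢ 0#
    1≢0 = 0≢1 ∘ sym

    ≢0-via : ∀ {x y} → x ≡ y → y ≢ 0# → x ≢ 0#
    ≢0-via x≡y y≢0 = y≢0 ∘ trans (sym x≡y)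

    data OvalPoint : Set where
      affine : Carrier → OvalPoint
      atInfinity nucleus : OvalPoint

    point : OvalPoint → V3
    point (affine t) = conicPoint t
    point atInfinity = conicPoint∞
    point nucleus    = nucleusPoint

    affine-injective : ∀ {a b} → affine a ≡ affine b → a ≡ b
    affine-injective refl = refl

    det≢0-conic³ : ∀ {a b c} → a ≢ b → a ≢ c → b ≢ c →
                   det (conicPoint a) (conicPoint b) (conicPoint c) ≢ 0#
    det≢0-conic³ {a} {b} {c} a≢b a≢c b≢c = ≢0-via
      (solve 3 (λ a b c → P.det (P.conicPoint a) (P.conicPoint b) (P.conicPoint c)
                            := (a :+ b) :* (a :+ c) :* (b :+ c)) refl a b c)
      (*-≢0 (*-≢0 (+-≢0 a≢b) (+-≢0 a≢c)) (+-≢0 b≢c))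

    det≢0-conic²-nucleus : ∀ {a b} → a ≢ b → det (conicPoint a) (conicPoint b) nucleusPoint ≢ 0#
    det≢0-conic²-nucleus {a} {b} a≢b = ≢0-via
      (solve 2 (λ a b → P.det (P.conicPoint a) (P.conicPoint b) P.nucleusPoint
                          := (a :+ b) :* (a :+ b)) refl a b)
      (*-≢0 (+-≢0 a≢b) (+-≢0 a≢b))

    det≢0-conic²-∞ : ∀ {a b} → a ≢ b → det (conicPoint a) (conicPoint b) conicPoint∞ ≢ 0#
    det≢0-conic²-∞ {a} {b} a≢b = ≢0-via
      (solve 2 (λ a b → P.det (P.conicPoint a) (P.conicPoint b) P.conicPoint∞ := a :+ b) refl a b)
      (+-≢0 a≢b)

    det≢0-conic-nucleus-∞ : ∀ a → det (conicPoint a) nucleusPoint conicPoint∞ ≢ 0#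
    det≢0-conic-nucleus-∞ a = ≢0-via
      (solve 1 (λ a → P.det (P.conicPoint a) P.nucleusPoint P.conicPoint∞ := con true) refl a)
      1≢0

    swap₀₁ : ∀ P Q R → det (point P) (point Q) (point R) ≢ 0# → det (point Q) (point P) (point R) ≢ 0#
    swap₀₁ P Q R = subst (_≢ 0#) (det-swap₀₁ (point P) (point Q) (point R))

    swap₁₂ : ∀ P Q R → det (point P) (point Q) (point R) ≢ 0# → det (point P) (point R) (point Q) ≢ 0#
    swap₁₂ P Q R = subst (_≢ 0#) (det-swap₁₂ (point P) (point Q) (point R))

    oval-det≢0 : ∀ P Q R → P ≢ Q → P ≢ R → Q ≢ R → det (point P) (point Q) (point R) ≢ 0#
    oval-det≢0 (affine a) (affine b) (affine c) P≢Q P≢R Q≢R =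
      det≢0-conic³ (P≢Q ∘ cong affine) (P≢R ∘ cong affine) (Q≢R ∘ cong affine)
    oval-det≢0 (affine a) (affine b) nucleus P≢Q _ _ = det≢0-conic²-nucleus (P≢Q ∘ cong affine)
    oval-det≢0 (affine a) nucleus (affine b) _ P≢R _ =
      swap₁₂ (affine a) (affine b) nucleus (det≢0-conic²-nucleus (P≢R ∘ cong affine))
    oval-det≢0 nucleus (affine a) (affine b) _ _ Q≢R =
      swap₀₁ (affine a) nucleus (affine b)
        (swap₁₂ (affine a) (affine b) nucleus (det≢0-conic²-nucleus (Q≢R ∘ cong affine)))
    oval-det≢0 (affine a) (affine b) atInfinity P≢Q _ _ = det≢0-conic²-∞ (P≢Q ∘ cong affine)
    oval-det≢0 (affine a) atInfinity (affine b) _ P≢R _ =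
      swap₁₂ (affine a) (affine b) atInfinity (det≢0-conic²-∞ (P≢R ∘ cong affine))
    oval-det≢0 atInfinity (affine a) (affine b) _ _ Q≢R =
      swap₀₁ (affine a) atInfinity (affine b)
        (swap₁₂ (affine a) (affine b) atInfinity (det≢0-conic²-∞ (Q≢R ∘ cong affine)))
    oval-det≢0 (affine a) nucleus atInfinity _ _ _ = det≢0-conic-nucleus-∞ a
    oval-det≢0 (affine a) atInfinity nucleus _ _ _ =
      swap₁₂ (affine a) nucleus atInfinity (det≢0-conic-nucleus-∞ a)
    oval-det≢0 nucleus (affine a) atInfinity _ _ _ =
      swap₀₁ (affine a) nucleus atInfinity (det≢0-conic-nucleus-∞ a)
    oval-det≢0 atInfinity (affine a) nucleus _ _ _ =
      swap₀₁ (affine a) atInfinity nucleus (swap₁₂ (affine a) nucleus atInfinity (det≢0-conic-nucleus-∞ a))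
    oval-det≢0 nucleus atInfinity (affine a) _ _ _ =
      swap₁₂ nucleus (affine a) atInfinity (swap₀₁ (affine a) nucleus atInfinity (det≢0-conic-nucleus-∞ a))
    oval-det≢0 atInfinity nucleus (affine a) _ _ _ =
      swap₀₁ nucleus atInfinity (affine a)
        (swap₁₂ nucleus (affine a) atInfinity (swap₀₁ (affine a) nucleus atInfinity (det≢0-conic-nucleus-∞ a)))
    oval-det≢0 nucleus    nucleus    _          P≢Q _ _ = ⊥-elim (P≢Q refl)
    oval-det≢0 atInfinity atInfinity _          P≢Q _ _ = ⊥-elim (P≢Q refl)
    oval-det≢0 nucleus    _          nucleus    _ P≢R _ = ⊥-elim (P≢R refl)
    oval-det≢0 atInfinity _          atInfinity _ P≢R _ = ⊥-elim (P≢R refl)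
    oval-det≢0 _          nucleus    nucleus    _ _ Q≢R = ⊥-elim (Q≢R refl)
    oval-det≢0 _          atInfinity atInfinity _ _ Q≢R = ⊥-elim (Q≢R refl)

    label : Fin q ⊎ Fin 2 → OvalPoint
    label (inj₁ i)  = affine (fromFin i)
    label (inj₂ 0F) = atInfinity
    label (inj₂ 1F) = nucleus

    label-injective : Injective _≡_ _≡_ label
    label-injective {inj₁ i}  {inj₁ j}  eq = cong inj₁ (fromFin-injective (affine-injective eq))
    label-injective {inj₂ 0F} {inj₂ 0F} _  = refl
    label-injective {inj₂ 1F} {inj₂ 1F} _  = refl
    label-injective {inj₁ _}  {inj₂ 0F} ()
    label-injective {inj₁ _}  {inj₂ 1F} ()
    label-injective {inj₂ 0F} {inj₁ _}  ()
    label-injective {inj₂ 0F} {inj₂ 1F} ()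
    label-injective {inj₂ 1F} {inj₁ _}  ()
    label-injective {inj₂ 1F} {inj₂ 0F} ()

    oval : Fin (q ℕ.+ 2) → OvalPoint
    oval = label ∘ splitAt q

    oval-injective : Injective _≡_ _≡_ oval
    oval-injective = Injection.injective (↔⇒↣ (+↔⊎ {q} {2})) ∘ label-injective

    t+t²-missedValue : ∃ λ e → ∀ t → t + t * t ≢ e
    t+t²-missedValue = ↔Fin-collision⇒missedValue card (λ t → t + t * t) 0≢1 (trans 0+0²≡0 (sym 1+1²≡0))
      where
      0+0²≡0 : 0# + 0# * 0# ≡ 0#
      0+0²≡0 = trans (cong (0# +_) (zeroʳ 0#)) (+-identityʳ 0#)

      1+1²≡0 : 1# + 1# * 1# ≡ 0#
      1+1²≡0 = trans (cong (1# +_) (*-identityʳ 1#)) 1+1≡0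

    module HyperovalAOA (e : Carrier) (t+t²≢e : ∀ t → t + t * t ≢ e) where

      line-det≢0 : ∀ P → det (point P) (lineThrough e 0F) (lineThrough e 1F) ≢ 0#
      line-det≢0 (affine t) = ≢0-via
        (solve 2 (λ e t → P.det (P.conicPoint t) (P.lineThrough e 0F) (P.lineThrough e 1F)
                            := t :+ t :* t :+ e) refl e t)
        (+-≢0 (t+t²≢e t))
      line-det≢0 atInfinity = ≢0-via
        (solve 1 (λ e → P.det P.conicPoint∞ (P.lineThrough e 0F) (P.lineThrough e 1F) := con true) refl e)
        1≢0
      line-det≢0 nucleus = ≢0-via
        (solve 1 (λ e → P.det P.nucleusPoint (P.lineThrough e 0F) (P.lineThrough e 1F) := con true) refl e)
        1≢0

      column : Fin ((q ℕ.+ 2) ℕ.+ 2) → V3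
      column = [ point ∘ oval , lineThrough e ]′ ∘ splitAt (q ℕ.+ 2)

      column-↑ˡ : ∀ j → column (j ↑ˡ 2) ≡ point (oval j)
      column-↑ˡ j = cong [ point ∘ oval , lineThrough e ]′ (splitAt-↑ˡ (q ℕ.+ 2) j 2)

      column-↑ʳ : ∀ j → column ((q ℕ.+ 2) ↑ʳ j) ≡ lineThrough e j
      column-↑ʳ j = cong [ point ∘ oval , lineThrough e ]′ (splitAt-↑ʳ (q ℕ.+ 2) 2 j)

      generator : Fin 3 → Fin ((q ℕ.+ 2) ℕ.+ 2) → Carrier
      generator r j = column j r

      orthogonal : ∀ (c : Fin 3 → Fin (q ℕ.+ 2)) → Injective _≡_ _≡_ c → (y : V3) →
                   ExactlyOne F 3 (λ x → ∀ i → x · column (c i ↑ˡ 2) ≡ y i)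
      orthogonal c c-injective y = ExactlyOne-map
        (λ x h i → trans (cong (x ·_) (column-↑ˡ (c i))) (h i))
        (λ x h i → trans (cong (x ·_) (sym (column-↑ˡ (c i)))) (h i))
        (cramer (point ∘ oval ∘ c) (oval-det≢0 _ _ _ (distinct λ ()) (distinct λ ()) (distinct λ ())) y)
        where
        distinct : ∀ {i j} → i ≢ j → oval (c i) ≢ oval (c j)
        distinct i≢j = i≢j ∘ c-injective ∘ oval-injective

      augmented : ∀ (d : Fin 1 → Fin (q ℕ.+ 2)) (y : Fin 1 → Carrier) (z : Fin 2 → Carrier) →
                  ExactlyOne F 3 (λ x → (∀ i → x · column (d i ↑ˡ 2) ≡ y i)
                                      × (∀ j → x · column ((q ℕ.+ 2) ↑ʳ j) ≡ z j))
      augmented d y z = ExactlyOne-map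
        (λ x h → (λ { 0F → trans (cong (x ·_) (column-↑ˡ (d 0F))) (h 0F) })
               , (λ j → trans (cong (x ·_) (column-↑ʳ j)) (h (suc j))))
        (λ x → λ { (h , _) 0F → trans (cong (x ·_) (sym (column-↑ˡ (d 0F)))) (h 0F)
                 ; (_ , h) (suc j) → trans (cong (x ·_) (sym (column-↑ʳ j))) (h j) })
        (cramer (point (oval (d 0F)) ∷ lineThrough e) (line-det≢0 (oval (d 0F))) (y 0F ∷ z))

      isLinearAOA : IsLinearAOAGen F 1 3 (q ℕ.+ 2) generator
      isLinearAOA = orthogonal , λ d _ → augmented d

    hyperovalAOA : LinearAOA F 1 3 (q ℕ.+ 2)
    hyperovalAOA = generator , isLinearAOA
      where open HyperovalAOA (proj₁ t+t²-missedValue) (proj₂ t+t²-missedValue)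

open import Data.Nat using (_+_; _≤_)

theorem3p9 : (q : ℕ) → 4 ≤ q → (∃ λ m → q ≡ 2 ^ m) →
    (F : FiniteField q) → LinearAOA F 1 3 (q + 2)
theorem3p9 q _ (m , q≡2^m) F = Characteristic2.hyperovalAOA F (characteristic-two F m q≡2^m)
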